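{- Let $T$ be a tournament and let $a_1,a_2\in V(T)$ be distinct vertices with $d^+_T(a_1),d^+_T(a_2)\ge 7$. Then $T$ contains an $(a_1,a_2)$-switch (as a subdigraph).
   Context: An $(a_1,a_2)$-switch is a digraph $D$ on $5$ distinct vertices $a_1,a_2,b,b_1,b_2$ where either $E(D)=\{a_1b,bb_1,bb_2,a_2b_1,a_2b_2\}$ or $E(D)=\{a_2b,bb_1,bb_2,a_1b_1,a_1b_2\}$ (here $xy$ denotes an edge directed from $x$ to $y$). $d^+_T(x)$ is the out-degree of $x$ in $T$. -}

module Defs where

open import Data.Nat using (ℕ)
open import Data.Fin using (Fin)
open import Data.Bool using (Bool; true; false)
open import Data.List using (List; filter; length; allFin)
open import Data.Product using (_×_; Σ-syntax)
open import Data.Sum using (_⊎_)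
open import Data.Empty using (⊥)
open import Relation.Nullary using (¬_)
open import Relation.Binary.PropositionalEquality using (_≡_; _≢_)
open import Data.Bool.Properties using () renaming (_≟_ to _≟ᵇ_)

-- A tournament on vertex set Fin n: adjacency `arc x y ≡ true` means
-- there is an edge directed from x to y.
record Tournament (n : ℕ) : Set where
  field
    arc       : Fin n → Fin n → Bool
    loopless  : ∀ x → arc x x ≡ false
    total     : ∀ x y → x ≢ y → (arc x y ≡ true) ⊎ (arc y x ≡ true)
    antisym   : ∀ x y → arc x y ≡ true → arc y x ≡ false
open Tournament public

Edge : ∀ {n} → Tournament n → Fin n → Fin n → Set
Edge T x y = arc T x y ≡ true

outdeg : ∀ {n} → Tournament n → Fin n → ℕ
outdeg {n} T x = length (filter (λ y → arc T x y ≟ᵇ true) (allFin n))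

Distinct5 : ∀ {n} → Fin n → Fin n → Fin n → Fin n → Fin n → Set
Distinct5 v w x y z =
  v ≢ w × v ≢ x × v ≢ y × v ≢ z ×
  w ≢ x × w ≢ y × w ≢ z ×
  x ≢ y × x ≢ z ×
  y ≢ z

ContainsSwitch : ∀ {n} → Tournament n → Fin n → Fin n → Set
ContainsSwitch {n} T a₁ a₂ =
  Σ[ b ∈ Fin n ] Σ[ b₁ ∈ Fin n ] Σ[ b₂ ∈ Fin n ]
    Distinct5 a₁ a₂ b b₁ b₂ ×
    ( (Edge T a₁ b × Edge T b b₁ × Edge T b b₂ × Edge T a₂ b₁ × Edge T a₂ b₂)
    ⊎ (Edge T a₂ b × Edge T b b₁ × Edge T b b₂ × Edge T a₁ b₁ × Edge T a₁ b₂) )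

-- Fix three out-neighbours y₁, y₂, y₃ of a₂ and two further out-neighbours x₁, x₂ of a₁,
-- all avoiding a₁, a₂ and each other; seven out-neighbours per vertex leave room for this.
-- If some xᵢ beats two of the yⱼ, then a₁ → xᵢ ⇉ {yⱼ, yₖ} ⇇ a₂ is a switch.  Otherwise, as T
-- is a tournament, each xᵢ is beaten by two of the three yⱼ; two 2-subsets of a 3-set meet,
-- so one yⱼ beats both x₁ and x₂, and a₂ → yⱼ ⇉ {x₁, x₂} ⇇ a₁ is a switch.
module Submission where

open import Defs
open import Data.Nat using (ℕ; _≥_; _<_; _≤_; s≤s)
open import Data.Nat.Properties using (≤-reflexive; ≤-trans; <ᵇ⇒<)
open import Data.Fin using (Fin)
import Data.Fin.Properties as Fin
open import Data.Bool using (true)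
open import Data.Bool.Properties using () renaming (_≟_ to _≟ᵇ_)
open import Data.List using (List; []; _∷_; filter; length; allFin)
open import Data.List.Properties using (length-removeAt′)
open import Data.List.Relation.Unary.Any using (any?; here; there; index; _─_)
import Data.List.Relation.Unary.Any as Any
open import Data.List.Relation.Unary.Any.Properties using (lookup-result)
open import Data.List.Relation.Unary.All using (All; []; _∷_)
import Data.List.Relation.Unary.All as All
open import Data.List.Relation.Unary.All.Properties using (¬Any⇒All¬; ─⁻)
open import Data.List.Relation.Unary.AllPairs using (_∷_)
open import Data.List.Relation.Unary.Unique.Propositional using (Unique)
open import Data.List.Relation.Unary.Unique.Propositional.Properties using (filter⁺; allFin⁺)
open import Data.List.Membership.Propositional using (_∈_)
open import Data.List.Membership.Propositional.Properties using (∈-filter⁻)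
open import Data.Product using (_×_; _,_; proj₂; ∃-syntax)
open import Data.Sum using (_⊎_; inj₁; inj₂)
import Data.Sum as Sum
open import Relation.Nullary using (yes; no; contradiction)
open import Relation.Binary.Definitions using (DecidableEquality)
open import Relation.Binary.PropositionalEquality using (_≢_; refl; sym; trans; ≢-sym)

module _ {a} {A : Set a} (_≟_ : DecidableEquality A) where

  ∃-fresh : ∀ (L F : List A) → Unique L → length F < length L →
            ∃[ y ] y ∈ L × All (y ≢_) F
  ∃-fresh (x ∷ xs) F (x∉xs ∷ xs-unique) (s≤s |F|≤|xs|) with any? (x ≟_) F
  ... | no x∉F = x , here refl , ¬Any⇒All¬ F x∉F
  ... | yes x∈F
    with ∃-fresh xs (F ─ x∈F) xs-unique
           (≤-trans (≤-reflexive (sym (length-removeAt′ F (index x∈F)))) |F|≤|xs|)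
  ... | y , y∈xs , y-fresh = y , there y∈xs , ─⁻ x∈F y≢x∈F y-fresh
    where
    y≢x∈F : y ≢ Any.lookup x∈F
    y≢x∈F y≡ = All.lookup x∉xs y∈xs (trans (lookup-result x∈F) (sym y≡))

module _ {n : ℕ} (T : Tournament n) where

  outNeighbours : Fin n → List (Fin n)
  outNeighbours a = filter (λ y → arc T a y ≟ᵇ true) (allFin n)

  ∃-fresh-out-neighbour : ∀ {k} a (F : List (Fin n)) → length F < k → k ≤ outdeg T a →
                          ∃[ y ] Edge T a y × All (y ≢_) F
  ∃-fresh-out-neighbour a F |F|<k k≤d⁺
    with y , y∈N⁺ , y-fresh ← ∃-fresh Fin._≟_ (outNeighbours a) F
                                (filter⁺ _ (allFin⁺ n)) (≤-trans |F|<k k≤d⁺)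
    = y , proj₂ (∈-filter⁻ (λ y → arc T a y ≟ᵇ true) {xs = allFin n} y∈N⁺) , y-fresh

  Edge⇒≢ : ∀ {x y} → Edge T x y → x ≢ y
  Edge⇒≢ {x} x→y refl = contradiction (trans (sym x→y) (loopless T x)) λ ()

  switch₁ : ∀ {a₁ a₂ b b₁ b₂} → a₁ ≢ a₂ → b ≢ a₂ → b₁ ≢ a₁ → b₂ ≢ a₁ → b₁ ≢ b₂ →
           Edge T a₁ b → Edge T b b₁ → Edge T b b₂ → Edge T a₂ b₁ → Edge T a₂ b₂ →
           ContainsSwitch T a₁ a₂
  switch₁ {b = b} {b₁} {b₂} a₁≢a₂ b≢a₂ b₁≢a₁ b₂≢a₁ b₁≢b₂ a₁b bb₁ bb₂ a₂b₁ a₂b₂ =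
    b , b₁ , b₂ ,
    ( a₁≢a₂ , Edge⇒≢ a₁b , ≢-sym b₁≢a₁ , ≢-sym b₂≢a₁ , ≢-sym b≢a₂ , Edge⇒≢ a₂b₁ , Edge⇒≢ a₂b₂
    , Edge⇒≢ bb₁ , Edge⇒≢ bb₂ , b₁≢b₂ ) ,
    inj₁ (a₁b , bb₁ , bb₂ , a₂b₁ , a₂b₂)

  switch₂ : ∀ {a₁ a₂ b b₁ b₂} → a₁ ≢ a₂ → b ≢ a₁ → b₁ ≢ a₂ → b₂ ≢ a₂ → b₁ ≢ b₂ →
            Edge T a₂ b → Edge T b b₁ → Edge T b b₂ → Edge T a₁ b₁ → Edge T a₁ b₂ →
            ContainsSwitch T a₁ a₂
  switch₂ a₁≢a₂ b≢a₁ b₁≢a₂ b₂≢a₂ b₁≢b₂ a₂b bb₁ bb₂ a₁b₁ a₁b₂ =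
    ContainsSwitch-sym (switch₁ (≢-sym a₁≢a₂) b≢a₁ b₁≢a₂ b₂≢a₂ b₁≢b₂ a₂b bb₁ bb₂ a₁b₁ a₁b₂)
    where
    ContainsSwitch-sym : ∀ {a₁ a₂} → ContainsSwitch T a₁ a₂ → ContainsSwitch T a₂ a₁
    ContainsSwitch-sym (b , b₁ , b₂ , (d₁₂ , d₁b , d₁b₁ , d₁b₂ , d₂b , d₂b₁ , d₂b₂ , rest) , edges) =
      b , b₁ , b₂ , (≢-sym d₁₂ , d₂b , d₂b₁ , d₂b₂ , d₁b , d₁b₁ , d₁b₂ , rest) , Sum.swap edges

TwoOf : Set → Set → Set → Set
TwoOf P₁ P₂ P₃ = (P₁ × P₂) ⊎ (P₁ × P₃) ⊎ (P₂ × P₃)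

TwoOf-majority : ∀ {P₁ P₂ P₃ Q₁ Q₂ Q₃ : Set} → P₁ ⊎ Q₁ → P₂ ⊎ Q₂ → P₃ ⊎ Q₃ →
                 TwoOf P₁ P₂ P₃ ⊎ TwoOf Q₁ Q₂ Q₃
TwoOf-majority (inj₁ p₁) (inj₁ p₂) _         = inj₁ (inj₁ (p₁ , p₂))
TwoOf-majority (inj₁ p₁) (inj₂ _)  (inj₁ p₃) = inj₁ (inj₂ (inj₁ (p₁ , p₃)))
TwoOf-majority (inj₁ _)  (inj₂ q₂) (inj₂ q₃) = inj₂ (inj₂ (inj₂ (q₂ , q₃)))
TwoOf-majority (inj₂ _)  (inj₁ p₂) (inj₁ p₃) = inj₁ (inj₂ (inj₂ (p₂ , p₃)))
TwoOf-majority (inj₂ q₁) (inj₁ _)  (inj₂ q₃) = inj₂ (inj₂ (inj₁ (q₁ , q₃)))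
TwoOf-majority (inj₂ q₁) (inj₂ q₂) _         = inj₂ (inj₁ (q₁ , q₂))

TwoOf-meet : ∀ {P₁ P₂ P₃ Q₁ Q₂ Q₃ : Set} → TwoOf P₁ P₂ P₃ → TwoOf Q₁ Q₂ Q₃ →
             (P₁ × Q₁) ⊎ (P₂ × Q₂) ⊎ (P₃ × Q₃)
TwoOf-meet (inj₁ (p₁ , _))        (inj₁ (q₁ , _))        = inj₁ (p₁ , q₁)
TwoOf-meet (inj₁ (p₁ , _))        (inj₂ (inj₁ (q₁ , _))) = inj₁ (p₁ , q₁)
TwoOf-meet (inj₁ (_ , p₂))        (inj₂ (inj₂ (q₂ , _))) = inj₂ (inj₁ (p₂ , q₂))
TwoOf-meet (inj₂ (inj₁ (p₁ , _))) (inj₁ (q₁ , _))        = inj₁ (p₁ , q₁)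
TwoOf-meet (inj₂ (inj₁ (p₁ , _))) (inj₂ (inj₁ (q₁ , _))) = inj₁ (p₁ , q₁)
TwoOf-meet (inj₂ (inj₁ (_ , p₃))) (inj₂ (inj₂ (_ , q₃))) = inj₂ (inj₂ (p₃ , q₃))
TwoOf-meet (inj₂ (inj₂ (p₂ , _))) (inj₁ (_ , q₂))        = inj₂ (inj₁ (p₂ , q₂))
TwoOf-meet (inj₂ (inj₂ (_ , p₃))) (inj₂ (inj₁ (_ , q₃))) = inj₂ (inj₂ (p₃ , q₃))
TwoOf-meet (inj₂ (inj₂ (p₂ , _))) (inj₂ (inj₂ (q₂ , _))) = inj₂ (inj₁ (p₂ , q₂))

module OutNeighbourTriple {n : ℕ} (T : Tournament n) {a₁ a₂ : Fin n} (a₁≢a₂ : a₁ ≢ a₂)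
         {y₁ y₂ y₃ : Fin n} (a₂y₁ : Edge T a₂ y₁) (a₂y₂ : Edge T a₂ y₂) (a₂y₃ : Edge T a₂ y₃)
         (y₁≢a₁ : y₁ ≢ a₁) (y₂≢a₁ : y₂ ≢ a₁) (y₃≢a₁ : y₃ ≢ a₁)
         (y₂≢y₁ : y₂ ≢ y₁) (y₃≢y₁ : y₃ ≢ y₁) (y₃≢y₂ : y₃ ≢ y₂) where

  beats-or-beaten-by-two : ∀ {x} → x ≢ y₁ → x ≢ y₂ → x ≢ y₃ →
    TwoOf (Edge T x y₁) (Edge T x y₂) (Edge T x y₃) ⊎ TwoOf (Edge T y₁ x) (Edge T y₂ x) (Edge T y₃ x)
  beats-or-beaten-by-two {x} x≢y₁ x≢y₂ x≢y₃ =
    TwoOf-majority (total T x y₁ x≢y₁) (total T x y₂ x≢y₂) (total T x y₃ x≢y₃)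

  beats-two⇒switch : ∀ {x} → Edge T a₁ x → x ≢ a₂ →
    TwoOf (Edge T x y₁) (Edge T x y₂) (Edge T x y₃) → ContainsSwitch T a₁ a₂
  beats-two⇒switch a₁x x≢a₂ (inj₁ (xy₁ , xy₂)) =
    switch₁ T a₁≢a₂ x≢a₂ y₁≢a₁ y₂≢a₁ (≢-sym y₂≢y₁) a₁x xy₁ xy₂ a₂y₁ a₂y₂
  beats-two⇒switch a₁x x≢a₂ (inj₂ (inj₁ (xy₁ , xy₃))) =
    switch₁ T a₁≢a₂ x≢a₂ y₁≢a₁ y₃≢a₁ (≢-sym y₃≢y₁) a₁x xy₁ xy₃ a₂y₁ a₂y₃
  beats-two⇒switch a₁x x≢a₂ (inj₂ (inj₂ (xy₂ , xy₃))) =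
    switch₁ T a₁≢a₂ x≢a₂ y₂≢a₁ y₃≢a₁ (≢-sym y₃≢y₂) a₁x xy₂ xy₃ a₂y₂ a₂y₃

  beaten-by-two⇒switch : ∀ {x₁ x₂} → Edge T a₁ x₁ → Edge T a₁ x₂ → x₁ ≢ a₂ → x₂ ≢ a₂ → x₁ ≢ x₂ →
    TwoOf (Edge T y₁ x₁) (Edge T y₂ x₁) (Edge T y₃ x₁) →
    TwoOf (Edge T y₁ x₂) (Edge T y₂ x₂) (Edge T y₃ x₂) → ContainsSwitch T a₁ a₂
  beaten-by-two⇒switch a₁x₁ a₁x₂ x₁≢a₂ x₂≢a₂ x₁≢x₂ beaten₁ beaten₂
    with TwoOf-meet beaten₁ beaten₂
  ... | inj₁ (y₁x₁ , y₁x₂) =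
    switch₂ T a₁≢a₂ y₁≢a₁ x₁≢a₂ x₂≢a₂ x₁≢x₂ a₂y₁ y₁x₁ y₁x₂ a₁x₁ a₁x₂
  ... | inj₂ (inj₁ (y₂x₁ , y₂x₂)) =
    switch₂ T a₁≢a₂ y₂≢a₁ x₁≢a₂ x₂≢a₂ x₁≢x₂ a₂y₂ y₂x₁ y₂x₂ a₁x₁ a₁x₂
  ... | inj₂ (inj₂ (y₃x₁ , y₃x₂)) =
    switch₂ T a₁≢a₂ y₃≢a₁ x₁≢a₂ x₂≢a₂ x₁≢x₂ a₂y₃ y₃x₁ y₃x₂ a₁x₁ a₁x₂

  switch-from-out-neighbours : ∀ {x₁ x₂} → Edge T a₁ x₁ → Edge T a₁ x₂ →
    x₁ ≢ a₂ → x₁ ≢ y₁ → x₁ ≢ y₂ → x₁ ≢ y₃ →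
    x₂ ≢ a₂ → x₂ ≢ y₁ → x₂ ≢ y₂ → x₂ ≢ y₃ → x₂ ≢ x₁ → ContainsSwitch T a₁ a₂
  switch-from-out-neighbours a₁x₁ a₁x₂ x₁≢a₂ x₁≢y₁ x₁≢y₂ x₁≢y₃ x₂≢a₂ x₂≢y₁ x₂≢y₂ x₂≢y₃ x₂≢x₁
    with beats-or-beaten-by-two x₁≢y₁ x₁≢y₂ x₁≢y₃ | beats-or-beaten-by-two x₂≢y₁ x₂≢y₂ x₂≢y₃
  ... | inj₁ x₁-beats  | _              = beats-two⇒switch a₁x₁ x₁≢a₂ x₁-beats
  ... | inj₂ _         | inj₁ x₂-beats  = beats-two⇒switch a₁x₂ x₂≢a₂ x₂-beats
  ... | inj₂ x₁-beaten | inj₂ x₂-beaten =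
    beaten-by-two⇒switch a₁x₁ a₁x₂ x₁≢a₂ x₂≢a₂ (≢-sym x₂≢x₁) x₁-beaten x₂-beaten

proposition4p2 : ∀ {n} (T : Tournament n) (a₁ a₂ : Fin n) → a₁ ≢ a₂ →
    outdeg T a₁ ≥ 7 → outdeg T a₂ ≥ 7 → ContainsSwitch T a₁ a₂
proposition4p2 T a₁ a₂ a₁≢a₂ d⁺a₁≥7 d⁺a₂≥7
  with y₁ , a₂y₁ , y₁≢a₁ ∷ []
         ← ∃-fresh-out-neighbour T a₂ (a₁ ∷ []) (<ᵇ⇒< _ _ _) d⁺a₂≥7
  with y₂ , a₂y₂ , y₂≢a₁ ∷ y₂≢y₁ ∷ []
         ← ∃-fresh-out-neighbour T a₂ (a₁ ∷ y₁ ∷ []) (<ᵇ⇒< _ _ _) d⁺a₂≥7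
  with y₃ , a₂y₃ , y₃≢a₁ ∷ y₃≢y₁ ∷ y₃≢y₂ ∷ []
         ← ∃-fresh-out-neighbour T a₂ (a₁ ∷ y₁ ∷ y₂ ∷ []) (<ᵇ⇒< _ _ _) d⁺a₂≥7
  with x₁ , a₁x₁ , x₁≢a₂ ∷ x₁≢y₁ ∷ x₁≢y₂ ∷ x₁≢y₃ ∷ []
         ← ∃-fresh-out-neighbour T a₁ (a₂ ∷ y₁ ∷ y₂ ∷ y₃ ∷ []) (<ᵇ⇒< _ _ _) d⁺a₁≥7
  with x₂ , a₁x₂ , x₂≢a₂ ∷ x₂≢y₁ ∷ x₂≢y₂ ∷ x₂≢y₃ ∷ x₂≢x₁ ∷ []
         ← ∃-fresh-out-neighbour T a₁ (a₂ ∷ y₁ ∷ y₂ ∷ y₃ ∷ x₁ ∷ []) (<ᵇ⇒< _ _ _) d⁺a₁≥7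
  = OutNeighbourTriple.switch-from-out-neighbours T a₁≢a₂ a₂y₁ a₂y₂ a₂y₃
      y₁≢a₁ y₂≢a₁ y₃≢a₁ y₂≢y₁ y₃≢y₁ y₃≢y₂
      a₁x₁ a₁x₂ x₁≢a₂ x₁≢y₁ x₁≢y₂ x₁≢y₃ x₂≢a₂ x₂≢y₁ x₂≢y₂ x₂≢y₃ x₂≢x₁
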